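{- Let $k$ be an odd positive integer such that $5k+2$ is prime, and let $m$ be a positive integer greater than $2$. Then $$F_{5mk}\equiv 5k\left(3^{m-1}+\sum_{i=1}^{m-1}3^{m-1-i}F_{3i-1}\right)\pmod{5k+2}$$ and $$F_{5mk+1}\equiv F_{3m-1}\pmod{5k+2}.$$
   Context: $(F_n)_{n\ge 0}$ denotes the Fibonacci sequence: $F_0=0$, $F_1=1$, $F_{n+2}=F_{n+1}+F_n$. -}

module Defs where

open import Data.Nat.Base using (ℕ; zero; suc; _+_; _*_)

F : ℕ → ℕ
F 0 = 0
F 1 = 1
F (suc (suc n)) = F (suc n) + F n

sumRange : (ℕ → ℕ) → ℕ → ℕ → ℕ
sumRange f a zero = 0
sumRange f a (suc n) = f a + sumRange f (suc a) n

-- Let p = 5k + 2 and K = 5k = p − 2. In ℕ[x]/(x⁵ − 1) the element y = x² + x³ behaves like −φ (for a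
-- primitive fifth root of unity ζ, ζ² + ζ³ is a root of y² + y − 1), so modulo multiples of
-- 1 + x + x² + x³ + x⁴ its odd powers are y^(2t+1) ≡ F(2t)(x + x⁴) + F(2t+2)(x² + x³). Modulo the prime p,
-- which is odd because k is, the binomial theorem gives y^p ≡ x^(2p) + x^(3p) = x⁴ + x, as p ≡ 2 (mod 5).
-- Comparing coefficients yields F(p−1) ≡ 1 and F(p+1) ≡ 0, hence F(K) ≡ −2 and F(K+1) ≡ 1, and so
-- F(N+K) ≡ 3F(N) − 2F(N+1) for every N. Induction on m then gives F(mK) ≡ −F(3m) and F(mK+1) ≡ F(3m−1),
-- and the theorem follows from −2 ≡ K and F(3m) = 2(3^(m−1) + Σ_{i=1}^{m−1} 3^(m−1−i) F(3i−1)).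

module Submission where

open import Defs
open import Data.Nat.Base as ℕ using (ℕ; zero; suc; NonZero)
open import Data.Nat.Primality using (Prime)
open import Data.Product using (_×_; ∃; _,_; proj₁; proj₂)
open import Relation.Binary.PropositionalEquality

-- The integer-valued part lives in local modules, so that the operators of ℤ do not clash with
-- those of ℕ, which are opened only after them.
module IntegerCongruence where

  open import Data.Integer.Base using (ℤ; +_; -[1+_]; _+_; _-_; _*_; -_)
  open import Data.Integer.Divisibility.Signed using (_∣_; divides; ∣m∣n⇒∣m+n; ∣m⇒∣-m; ∣n⇒∣m*n; ∣m⇒∣m*n)
  open import Data.Integer.Properties using (pos-*; +-injective)
  open import Data.Integer.Tactic.RingSolver using (solve-∀)
  open import Data.Nat.DivMod using (_%_; _/_; [m+kn]%n≡m%n; m≡m%n+[m/n]*n)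
  open import Relation.Binary.Bundles using (Setoid)
  open import Relation.Binary.Structures using (IsEquivalence)

  -- A record rather than a synonym for + n ∣ x - y, so that x and y can be inferred.
  infix 4 _≡_mod_
  record _≡_mod_ (x y : ℤ) (n : ℕ) : Set where
    constructor congruent
    field
      divides-difference : + n ∣ x - y

  module _ {n : ℕ} where

    ≡⇒≡-mod : ∀ {x y} → x ≡ y → x ≡ y mod n
    ≡⇒≡-mod {x} refl = congruent (divides (+ 0) (x-x≡0*n x (+ n)))
      where
      x-x≡0*n : ∀ x n → x - x ≡ + 0 * n
      x-x≡0*n = solve-∀

    mod-sym : ∀ {x y} → x ≡ y mod n → y ≡ x mod n
    mod-sym {x} {y} (congruent n∣x-y) = congruent (subst (+ n ∣_) (-[x-y]≡y-x x y) (∣m⇒∣-m n∣x-y))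
      where
      -[x-y]≡y-x : ∀ x y → - (x - y) ≡ y - x
      -[x-y]≡y-x = solve-∀

    mod-trans : ∀ {x y z} → x ≡ y mod n → y ≡ z mod n → x ≡ z mod n
    mod-trans {x} {y} {z} (congruent n∣x-y) (congruent n∣y-z) =
      congruent (subst (+ n ∣_) ([x-y]+[y-z]≡x-z x y z) (∣m∣n⇒∣m+n n∣x-y n∣y-z))
      where
      [x-y]+[y-z]≡x-z : ∀ x y z → (x - y) + (y - z) ≡ x - z
      [x-y]+[y-z]≡x-z = solve-∀

    +-cong-mod : ∀ {x y u v} → x ≡ y mod n → u ≡ v mod n → x + u ≡ y + v mod n
    +-cong-mod {x} {y} {u} {v} (congruent n∣x-y) (congruent n∣u-v) =
      congruent (subst (+ n ∣_) ([x-y]+[u-v]≡[x+u]-[y+v] x y u v) (∣m∣n⇒∣m+n n∣x-y n∣u-v))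
      where
      [x-y]+[u-v]≡[x+u]-[y+v] : ∀ x y u v → (x - y) + (u - v) ≡ (x + u) - (y + v)
      [x-y]+[u-v]≡[x+u]-[y+v] = solve-∀

    -‿cong-mod : ∀ {x y} → x ≡ y mod n → - x ≡ - y mod n
    -‿cong-mod {x} {y} (congruent n∣x-y) = congruent (subst (+ n ∣_) (-[x-y]≡[-x]-[-y] x y) (∣m⇒∣-m n∣x-y))
      where
      -[x-y]≡[-x]-[-y] : ∀ x y → - (x - y) ≡ - x - - y
      -[x-y]≡[-x]-[-y] = solve-∀

    *-cong-mod : ∀ {x y u v} → x ≡ y mod n → u ≡ v mod n → x * u ≡ y * v mod n
    *-cong-mod {x} {y} {u} {v} (congruent n∣x-y) (congruent n∣u-v) =
      congruent (subst (+ n ∣_) ([x-y]u+y[u-v]≡xu-yv x y u v) (∣m∣n⇒∣m+n (∣m⇒∣m*n u n∣x-y) (∣n⇒∣m*n y n∣u-v)))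
      where
      [x-y]u+y[u-v]≡xu-yv : ∀ x y u v → (x - y) * u + y * (u - v) ≡ x * u - y * v
      [x-y]u+y[u-v]≡xu-yv = solve-∀

    *-congˡ-mod : ∀ x {y z} → y ≡ z mod n → x * y ≡ x * z mod n
    *-congˡ-mod x = *-cong-mod (≡⇒≡-mod {x} refl)

    mod-isEquivalence : IsEquivalence (λ x y → x ≡ y mod n)
    mod-isEquivalence = record { refl = ≡⇒≡-mod refl ; sym = mod-sym ; trans = mod-trans }

    mod-setoid : Setoid _ _
    mod-setoid = record { isEquivalence = mod-isEquivalence }

  module _ {n : ℕ} .{{_ : NonZero n}} where

    %≡%⇒≡-mod : ∀ {a b} → a % n ≡ b % n → + a ≡ + b mod n
    %≡%⇒≡-mod {a} {b} a%n≡b%n = congruent (divides (+ (a / n) - + (b / n)) (begin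
      + a - + b                                                 ≡⟨ cong₂ (λ a b → + a - + b) (m≡m%n+[m/n]*n a n) (m≡m%n+[m/n]*n b n) ⟩
      + (a % n ℕ.+ a / n ℕ.* n) - + (b % n ℕ.+ b / n ℕ.* n)     ≡⟨ cong (λ r → + (a % n ℕ.+ a / n ℕ.* n) - + (r ℕ.+ b / n ℕ.* n)) a%n≡b%n ⟨
      + (a % n ℕ.+ a / n ℕ.* n) - + (a % n ℕ.+ b / n ℕ.* n)     ≡⟨ cong₂ (λ x y → + (a % n) + x - (+ (a % n) + y)) (pos-* (a / n) n) (pos-* (b / n) n) ⟩
      + (a % n) + + (a / n) * + n - (+ (a % n) + + (b / n) * + n) ≡⟨ [r+xn]-[r+yn]≡[x-y]n (+ (a % n)) (+ (a / n)) (+ (b / n)) (+ n) ⟩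
      (+ (a / n) - + (b / n)) * + n                             ∎))
      where
      open ≡-Reasoning
      [r+xn]-[r+yn]≡[x-y]n : ∀ r x y n → r + x * n - (r + y * n) ≡ (x - y) * n
      [r+xn]-[r+yn]≡[x-y]n = solve-∀

    a≡b+sn⇒%≡% : ∀ a b s → + a ≡ + b + + s * + n → a % n ≡ b % n
    a≡b+sn⇒%≡% a b s a≡b+sn =
      trans (cong (_% n) (+-injective (trans a≡b+sn (cong (_+_ (+ b)) (sym (pos-* s n)))))) ([m+kn]%n≡m%n b s n)

    ≡-mod⇒%≡% : ∀ {a b} → + a ≡ + b mod n → a % n ≡ b % n
    ≡-mod⇒%≡% {a} {b} (congruent (divides (+ s) a-b≡sn)) = a≡b+sn⇒%≡% a b s (begin
      + a                  ≡⟨ a≡b+[a-b] (+ a) (+ b) ⟩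
      + b + (+ a - + b)    ≡⟨ cong (_+_ (+ b)) a-b≡sn ⟩
      + b + + s * + n      ∎)
      where
      open ≡-Reasoning
      a≡b+[a-b] : ∀ a b → a ≡ b + (a - b)
      a≡b+[a-b] = solve-∀
    ≡-mod⇒%≡% {a} {b} (congruent (divides -[1+ s ] a-b≡-sn)) = sym (a≡b+sn⇒%≡% b a (suc s) (begin
      + b                            ≡⟨ b≡a-[a-b] (+ a) (+ b) ⟩
      + a - (+ a - + b)              ≡⟨ cong (λ d → + a - d) a-b≡-sn ⟩
      + a - - + suc s * + n          ≡⟨ cong (_+_ (+ a)) (-[-s*n]≡s*n (+ suc s) (+ n)) ⟩
      + a + + suc s * + n            ∎))
      where
      open ≡-Reasoning
      b≡a-[a-b] : ∀ a b → b ≡ a - (a - b)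
      b≡a-[a-b] = solve-∀
      -[-s*n]≡s*n : ∀ s n → - (- s * n) ≡ s * n
      -[-s*n]≡s*n = solve-∀

module FibonacciModulo where

  open IntegerCongruence
  open import Data.Integer.Base using (ℤ; +_; _+_; _-_; _*_; -_)
  open import Data.Integer.Divisibility.Signed using (divides)
  open import Data.Integer.Properties using (pos-*)
  open import Data.Integer.Tactic.RingSolver using (solve-∀)
  open import Data.Nat.DivMod using (_%_)
  open import Data.Nat.Properties using (+-comm; *-suc)
  import Relation.Binary.Reasoning.Setoid as ≈-Reasoning

  Fℤ : ℕ → ℤ
  Fℤ n = + F n

  FibonacciRecurrence : (ℕ → ℤ) → Set
  FibonacciRecurrence u = ∀ n → u (2 ℕ.+ n) ≡ u (1 ℕ.+ n) + u n

  Fℤ-recurrence : FibonacciRecurrence Fℤ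
  Fℤ-recurrence n = refl

  module _ {P : ℕ} where
    open ≈-Reasoning (mod-setoid {P})

    FibonacciRecurrence⇒≡-mod : ∀ {u v} → FibonacciRecurrence u → FibonacciRecurrence v →
      u 0 ≡ v 0 mod P → u 1 ≡ v 1 mod P → ∀ n → u n ≡ v n mod P
    FibonacciRecurrence⇒≡-mod {u} {v} u-rec v-rec u₀≡v₀ u₁≡v₁ = agree
      where
      agree : ∀ n → u n ≡ v n mod P
      agree 0 = u₀≡v₀
      agree 1 = u₁≡v₁
      agree (suc (suc n)) = begin
        u (2 ℕ.+ n)         ≡⟨ u-rec n ⟩
        u (1 ℕ.+ n) + u n   ≈⟨ +-cong-mod (agree (suc n)) (agree n) ⟩
        v (1 ℕ.+ n) + v n   ≡⟨ v-rec n ⟨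
        v (2 ℕ.+ n)         ∎

  module _ (K : ℕ) (F[1+K]≡1 : F (1 ℕ.+ K) % (2 ℕ.+ K) ≡ 1 % (2 ℕ.+ K)) (F[3+K]≡0 : F (3 ℕ.+ K) % (2 ℕ.+ K) ≡ 0) where

    open ≈-Reasoning (mod-setoid {2 ℕ.+ K})

    Fℤ[1+K]≡1 : Fℤ (1 ℕ.+ K) ≡ + 1 mod 2 ℕ.+ K
    Fℤ[1+K]≡1 = %≡%⇒≡-mod F[1+K]≡1

    Fℤ[3+K]≡0 : Fℤ (3 ℕ.+ K) ≡ + 0 mod 2 ℕ.+ K
    Fℤ[3+K]≡0 = %≡%⇒≡-mod F[3+K]≡0

    Fℤ[K]≡-2 : Fℤ K ≡ - + 2 mod 2 ℕ.+ K
    Fℤ[K]≡-2 = begin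
      Fℤ K                                   ≡⟨ a≡[b+a+b]-2b (Fℤ K) (Fℤ (1 ℕ.+ K)) ⟩
      Fℤ (3 ℕ.+ K) - + 2 * Fℤ (1 ℕ.+ K)      ≈⟨ +-cong-mod Fℤ[3+K]≡0 (-‿cong-mod (*-congˡ-mod (+ 2) Fℤ[1+K]≡1)) ⟩
      - + 2                                  ∎
      where
      a≡[b+a+b]-2b : ∀ a b → a ≡ ((b + a) + b) - + 2 * b
      a≡[b+a+b]-2b = solve-∀

    F[N+K]≡3F[N]-2F[1+N] : ∀ N → Fℤ (N ℕ.+ K) ≡ + 3 * Fℤ N - + 2 * Fℤ (1 ℕ.+ N) mod 2 ℕ.+ K
    F[N+K]≡3F[N]-2F[1+N] = FibonacciRecurrence⇒≡-mod (λ N → Fℤ-recurrence (N ℕ.+ K)) rhs-recurrence Fℤ[K]≡-2 Fℤ[1+K]≡1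
      where
      3[b+a]-2[b+a+b]≡[3b-2[b+a]]+[3a-2b] : ∀ a b → + 3 * (b + a) - + 2 * ((b + a) + b) ≡ (+ 3 * b - + 2 * (b + a)) + (+ 3 * a - + 2 * b)
      3[b+a]-2[b+a+b]≡[3b-2[b+a]]+[3a-2b] = solve-∀
      rhs-recurrence : FibonacciRecurrence (λ N → + 3 * Fℤ N - + 2 * Fℤ (1 ℕ.+ N))
      rhs-recurrence N = 3[b+a]-2[b+a+b]≡[3b-2[b+a]]+[3a-2b] (Fℤ N) (Fℤ (1 ℕ.+ N))

    F-at-multiples-of-K : ∀ m → Fℤ (m ℕ.* K) ≡ - Fℤ (3 ℕ.* m) mod 2 ℕ.+ K
                    × Fℤ (1 ℕ.+ m ℕ.* K) ≡ Fℤ (1 ℕ.+ 3 ℕ.* m) - Fℤ (3 ℕ.* m) mod 2 ℕ.+ K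
    F-at-multiples-of-K zero    = ≡⇒≡-mod refl , ≡⇒≡-mod refl
    F-at-multiples-of-K (suc m) = F[K+x]≡-F[3+3m] , F[1+K+x]≡F[4+3m]-F[3+3m]
      where
      x : ℕ
      x = m ℕ.* K
      b c : ℤ
      b = Fℤ (3 ℕ.* m)
      c = Fℤ (1 ℕ.+ 3 ℕ.* m)
      F[x]≡-b : Fℤ x ≡ - b mod 2 ℕ.+ K
      F[x]≡-b = proj₁ (F-at-multiples-of-K m)
      F[1+x]≡c-b : Fℤ (1 ℕ.+ x) ≡ c - b mod 2 ℕ.+ K
      F[1+x]≡c-b = proj₂ (F-at-multiples-of-K m)
      F[K+x]≡-F[3+3m] : Fℤ (K ℕ.+ x) ≡ - Fℤ (3 ℕ.* suc m) mod 2 ℕ.+ K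
      F[K+x]≡-F[3+3m] = begin
        Fℤ (K ℕ.+ x)                               ≡⟨ cong Fℤ (+-comm K x) ⟩
        Fℤ (x ℕ.+ K)                               ≈⟨ F[N+K]≡3F[N]-2F[1+N] x ⟩
        + 3 * Fℤ x - + 2 * Fℤ (1 ℕ.+ x)            ≈⟨ +-cong-mod (*-congˡ-mod (+ 3) F[x]≡-b)
                                                        (-‿cong-mod (*-congˡ-mod (+ 2) F[1+x]≡c-b)) ⟩
        + 3 * - b - + 2 * (c - b)                  ≡⟨ 3[-b]-2[c-b]≡-[c+b+c] b c ⟩
        - Fℤ (3 ℕ.+ 3 ℕ.* m)                       ≡⟨ cong (λ i → - Fℤ i) (*-suc 3 m) ⟨
        - Fℤ (3 ℕ.* suc m)                         ∎
        where
        3[-b]-2[c-b]≡-[c+b+c] : ∀ b c → + 3 * - b - + 2 * (c - b) ≡ - ((c + b) + c)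
        3[-b]-2[c-b]≡-[c+b+c] = solve-∀
      F[1+K+x]≡F[4+3m]-F[3+3m] : Fℤ (1 ℕ.+ (K ℕ.+ x)) ≡ Fℤ (1 ℕ.+ 3 ℕ.* suc m) - Fℤ (3 ℕ.* suc m) mod 2 ℕ.+ K
      F[1+K+x]≡F[4+3m]-F[3+3m] = begin
        Fℤ (1 ℕ.+ (K ℕ.+ x))                       ≡⟨ cong (λ i → Fℤ (suc i)) (+-comm K x) ⟩
        Fℤ ((1 ℕ.+ x) ℕ.+ K)                       ≈⟨ F[N+K]≡3F[N]-2F[1+N] (1 ℕ.+ x) ⟩
        + 3 * Fℤ (1 ℕ.+ x) - + 2 * Fℤ (2 ℕ.+ x)    ≈⟨ +-cong-mod (*-congˡ-mod (+ 3) F[1+x]≡c-b)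
                                                        (-‿cong-mod (*-congˡ-mod (+ 2) (+-cong-mod F[1+x]≡c-b F[x]≡-b))) ⟩
        + 3 * (c - b) - + 2 * ((c - b) + - b)      ≡⟨ 3[c-b]-2[c-b-b]≡[c+b+c+[c+b]]-[c+b+c] b c ⟩
        Fℤ (4 ℕ.+ 3 ℕ.* m) - Fℤ (3 ℕ.+ 3 ℕ.* m)    ≡⟨ cong (λ i → Fℤ (suc i) - Fℤ i) (*-suc 3 m) ⟨
        Fℤ (1 ℕ.+ 3 ℕ.* suc m) - Fℤ (3 ℕ.* suc m)  ∎
        where
        3[c-b]-2[c-b-b]≡[c+b+c+[c+b]]-[c+b+c] : ∀ b c → + 3 * (c - b) - + 2 * ((c - b) + - b) ≡ (((c + b) + c) + (c + b)) - ((c + b) + c)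
        3[c-b]-2[c-b-b]≡[c+b+c+[c+b]]-[c+b+c] = solve-∀

    K≡-2 : + K ≡ - + 2 mod 2 ℕ.+ K
    K≡-2 = congruent (divides (+ 1) (k-[-2]≡1*[2+k] (+ K)))
      where
      k-[-2]≡1*[2+k] : ∀ k → k - - + 2 ≡ + 1 * (+ 2 + k)
      k-[-2]≡1*[2+k] = solve-∀

    F[mK]≡K*S×F[mK+1]≡F[3m-1] : ∀ n S → 2 ℕ.* S ≡ F (3 ℕ.* suc n) →
      F (suc n ℕ.* K) % (2 ℕ.+ K) ≡ (K ℕ.* S) % (2 ℕ.+ K)
      × F (suc n ℕ.* K ℕ.+ 1) % (2 ℕ.+ K) ≡ F (3 ℕ.* suc n ℕ.∸ 1) % (2 ℕ.+ K)
    F[mK]≡K*S×F[mK+1]≡F[3m-1] n S 2S≡F[3m] = ≡-mod⇒%≡% F[mK]≡KS , ≡-mod⇒%≡% F[mK+1]≡F[3m-1]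
      where
      F[mK]≡KS : Fℤ (suc n ℕ.* K) ≡ + (K ℕ.* S) mod 2 ℕ.+ K
      F[mK]≡KS = begin
        Fℤ (suc n ℕ.* K)          ≈⟨ proj₁ (F-at-multiples-of-K (suc n)) ⟩
        - Fℤ (3 ℕ.* suc n)        ≡⟨ cong (λ i → - + i) 2S≡F[3m] ⟨
        - + (2 ℕ.* S)             ≡⟨ cong -_ (pos-* 2 S) ⟩
        - (+ 2 * + S)             ≡⟨ -[a*s]≡[-a]*s (+ 2) (+ S) ⟩
        - + 2 * + S               ≈⟨ *-cong-mod K≡-2 (≡⇒≡-mod refl) ⟨
        + K * + S                 ≡⟨ pos-* K S ⟨
        + (K ℕ.* S)               ∎
        where
        -[a*s]≡[-a]*s : ∀ a s → - (a * s) ≡ - a * s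
        -[a*s]≡[-a]*s = solve-∀
      F[mK+1]≡F[3m-1] : Fℤ (suc n ℕ.* K ℕ.+ 1) ≡ Fℤ (3 ℕ.* suc n ℕ.∸ 1) mod 2 ℕ.+ K
      F[mK+1]≡F[3m-1] = begin
        Fℤ (suc n ℕ.* K ℕ.+ 1)                     ≡⟨ cong Fℤ (+-comm (suc n ℕ.* K) 1) ⟩
        Fℤ (1 ℕ.+ suc n ℕ.* K)                     ≈⟨ proj₂ (F-at-multiples-of-K (suc n)) ⟩
        Fℤ (1 ℕ.+ 3 ℕ.* suc n) - Fℤ (3 ℕ.* suc n)  ≡⟨ cong (λ i → Fℤ (suc i) - Fℤ i) (*-suc 3 n) ⟩
        Fℤ (4 ℕ.+ 3 ℕ.* n) - Fℤ (3 ℕ.+ 3 ℕ.* n)    ≡⟨ [b+a+b+[b+a]]-[b+a+b]≡b+a (Fℤ (3 ℕ.* n)) (Fℤ (1 ℕ.+ 3 ℕ.* n)) ⟩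
        Fℤ (2 ℕ.+ 3 ℕ.* n)                         ≡⟨ cong (λ i → Fℤ (i ℕ.∸ 1)) (*-suc 3 n) ⟨
        Fℤ (3 ℕ.* suc n ℕ.∸ 1)                     ∎
        where
        [b+a+b+[b+a]]-[b+a+b]≡b+a : ∀ a b → (((b + a) + b) + (b + a)) - ((b + a) + b) ≡ b + a
        [b+a+b+[b+a]]-[b+a+b]≡b+a = solve-∀

open FibonacciModulo using (F[mK]≡K*S×F[mK+1]≡F[3m-1])
open import Data.Bool.Base using (if_then_else_)
open import Data.List.Base using (_∷_; [])
open import Data.Nat.Base using (_+_; _*_; _∸_; _^_; _≤_; _<_; _>_; z<s; s≤s; _≡ᵇ_)
open import Data.Nat.Combinatorics using (_C_; nCk+nC[k+1]≡[n+1]C[k+1]; nCn≡1; k>n⇒nCk≡0)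
open import Data.Nat.Divisibility using (_∣_; divides; _∣0; ∣m∣n⇒∣m+n; ∣⇒≤; ∣-trans; m∣m*n; m%n≡0⇒n∣m)
open import Data.Nat.DivMod using (_%_; %-distribˡ-+; %-distribˡ-*; m%n%n≡m%n; %-remove-+ˡ; %-remove-+ʳ; [m+kn]%n≡m%n)
open import Data.Nat.Primality using (euclidsLemma)
open import Data.Nat.Properties
open import Data.Nat.Tactic.RingSolver using (solve-∀; solve)
open import Data.Sum using (inj₁; inj₂)
open import Function.Base using (_∘_)
open import Relation.Nullary.Negation using (contradiction)

module _ {f g : ℕ → ℕ} where

  sumRange-cong : ∀ a n → (∀ i → a ≤ i → i < a + n → f i ≡ g i) → sumRange f a n ≡ sumRange g a n
  sumRange-cong a zero     _   = refl
  sumRange-cong a (suc n) f≗g = cong₂ _+_ (f≗g a ≤-refl (m<m+n a z<s))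
    (sumRange-cong (suc a) n λ i a<i i<1+a+n → f≗g i (<⇒≤ a<i) (subst (i <_) (sym (+-suc a n)) i<1+a+n))

sumRange-+ : ∀ f g a n → sumRange (λ i → f i + g i) a n ≡ sumRange f a n + sumRange g a n
sumRange-+ f g a zero    = refl
sumRange-+ f g a (suc n) = trans (cong (f a + g a +_) (sumRange-+ f g (suc a) n))
  (w+x+[y+z]≡w+y+[x+z] (f a) (g a) (sumRange f (suc a) n) (sumRange g (suc a) n))
  where
  w+x+[y+z]≡w+y+[x+z] : ∀ w x y z → w + x + (y + z) ≡ w + y + (x + z)
  w+x+[y+z]≡w+y+[x+z] = solve-∀

module _ (f : ℕ → ℕ) where

  sumRange-shift : ∀ a n → sumRange f (suc a) n ≡ sumRange (f ∘ suc) a n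
  sumRange-shift a zero    = refl
  sumRange-shift a (suc n) = cong (f (suc a) +_) (sumRange-shift (suc a) n)

  sumRange-snoc : ∀ a n → sumRange f a (suc n) ≡ sumRange f a n + f (a + n)
  sumRange-snoc a zero    = trans (+-identityʳ (f a)) (cong f (sym (+-identityʳ a)))
  sumRange-snoc a (suc n) = begin
    f a + sumRange f (suc a) (suc n)                ≡⟨ cong (f a +_) (sumRange-snoc (suc a) n) ⟩
    f a + (sumRange f (suc a) n + f (suc a + n))    ≡⟨ +-assoc (f a) _ _ ⟨
    f a + sumRange f (suc a) n + f (suc (a + n))    ≡⟨ cong (λ i → f a + sumRange f (suc a) n + f i) (+-suc a n) ⟨
    f a + sumRange f (suc a) n + f (a + suc n)      ∎
    where open ≡-Reasoning

  sumRange-*ˡ : ∀ c a n → sumRange (λ i → c * f i) a n ≡ c * sumRange f a n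
  sumRange-*ˡ c a zero    = sym (*-zeroʳ c)
  sumRange-*ˡ c a (suc n) = trans (cong (c * f a +_) (sumRange-*ˡ c (suc a) n)) (sym (*-distribˡ-+ c (f a) _))

  sumRange-∣ : ∀ {d} a n → (∀ i → a ≤ i → i < a + n → d ∣ f i) → d ∣ sumRange f a n
  sumRange-∣ {d} a zero    _   = d ∣0
  sumRange-∣ a (suc n) d∣f = ∣m∣n⇒∣m+n (d∣f a ≤-refl (m<m+n a z<s))
    (sumRange-∣ (suc a) n λ i a<i i<1+a+n → d∣f i (<⇒≤ a<i) (subst (i <_) (sym (+-suc a n)) i<1+a+n))

[1+k]*[1+n]C[1+k]≡[1+n]*nCk : ∀ n k → suc k * (suc n C suc k) ≡ suc n * (n C k)
k*[1+n]Ck+[1+n]*nCk≡[1+n]*[1+n]Ck : ∀ n k → k * (suc n C k) + suc n * (n C k) ≡ suc n * (suc n C k)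

[1+k]*[1+n]C[1+k]≡[1+n]*nCk zero    zero    = refl
[1+k]*[1+n]C[1+k]≡[1+n]*nCk zero    (suc k) = *-zeroʳ (suc (suc k))
[1+k]*[1+n]C[1+k]≡[1+n]*nCk (suc n) k       = begin
  suc k * (suc (suc n) C suc k)                       ≡⟨ cong (suc k *_) (nCk+nC[k+1]≡[n+1]C[k+1] (suc n) k) ⟨
  suc k * (suc n C k + suc n C suc k)                 ≡⟨ *-distribˡ-+ (suc k) (suc n C k) _ ⟩
  suc k * (suc n C k) + suc k * (suc n C suc k)       ≡⟨ cong (suc k * (suc n C k) +_) ([1+k]*[1+n]C[1+k]≡[1+n]*nCk n k) ⟩
  suc k * (suc n C k) + suc n * (n C k)               ≡⟨ [1+b]a+c≡a+[ba+c] (suc n C k) k (suc n * (n C k)) ⟩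
  suc n C k + (k * (suc n C k) + suc n * (n C k))     ≡⟨ cong (suc n C k +_) (k*[1+n]Ck+[1+n]*nCk≡[1+n]*[1+n]Ck n k) ⟩
  suc (suc n) * (suc n C k)                           ∎
  where
  open ≡-Reasoning
  [1+b]a+c≡a+[ba+c] : ∀ a b c → suc b * a + c ≡ a + (b * a + c)
  [1+b]a+c≡a+[ba+c] = solve-∀

k*[1+n]Ck+[1+n]*nCk≡[1+n]*[1+n]Ck n zero    = refl
k*[1+n]Ck+[1+n]*nCk≡[1+n]*[1+n]Ck n (suc k) = begin
  suc k * (suc n C suc k) + suc n * (n C suc k)       ≡⟨ cong (_+ suc n * (n C suc k)) ([1+k]*[1+n]C[1+k]≡[1+n]*nCk n k) ⟩
  suc n * (n C k) + suc n * (n C suc k)               ≡⟨ *-distribˡ-+ (suc n) (n C k) _ ⟨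
  suc n * (n C k + n C suc k)                         ≡⟨ cong (suc n *_) (nCk+nC[k+1]≡[n+1]C[k+1] n k) ⟩
  suc n * (suc n C suc k)                             ∎
  where open ≡-Reasoning

prime∣pCk : ∀ {p k} → Prime p → 0 < k → k < p → p ∣ p C k
prime∣pCk {suc p} {suc k} p-prime _ k<p with euclidsLemma (suc k) (suc p C suc k) p-prime
  (divides (p C k) (trans ([1+k]*[1+n]C[1+k]≡[1+n]*nCk p k) (*-comm (suc p) (p C k))))
... | inj₁ p∣k   = contradiction (∣⇒≤ p∣k) (<⇒≱ k<p)
... | inj₂ p∣pCk = p∣pCk

binomialSum : ℕ → (ℕ → ℕ) → ℕ
binomialSum zero    g = g 0
binomialSum (suc n) g = binomialSum n g + binomialSum n (g ∘ suc)

binomialSum-cong : ∀ n {g h} → (∀ j → g j ≡ h j) → binomialSum n g ≡ binomialSum n h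
binomialSum-cong zero    g≗h = g≗h 0
binomialSum-cong (suc n) g≗h = cong₂ _+_ (binomialSum-cong n g≗h) (binomialSum-cong n (g≗h ∘ suc))

binomialSum≡Σ : ∀ n g → binomialSum n g ≡ sumRange (λ j → (n C j) * g j) 0 (suc n)
binomialSum≡Σ zero    g = sym (trans (+-identityʳ _) (+-identityʳ (g 0)))
binomialSum≡Σ (suc n) g = begin
  binomialSum n g + binomialSum n (g ∘ suc)
    ≡⟨ cong₂ _+_ (binomialSum≡Σ n g) (binomialSum≡Σ n (g ∘ suc)) ⟩
  1 * g 0 + sumRange (λ j → (n C j) * g j) 1 n + sumRange (λ j → (n C j) * g (suc j)) 0 (suc n)
    ≡⟨ a+b+c≡a+[c+b] (1 * g 0) _ _ ⟩
  1 * g 0 + (sumRange (λ j → (n C j) * g (suc j)) 0 (suc n) + sumRange (λ j → (n C j) * g j) 1 n)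
    ≡⟨ cong (λ s → 1 * g 0 + (sumRange (λ j → (n C j) * g (suc j)) 0 (suc n) + s)) upper ⟩
  1 * g 0 + (sumRange (λ j → (n C j) * g (suc j)) 0 (suc n) + sumRange (λ j → (n C suc j) * g (suc j)) 0 (suc n))
    ≡⟨ cong (1 * g 0 +_) (sumRange-+ (λ j → (n C j) * g (suc j)) (λ j → (n C suc j) * g (suc j)) 0 (suc n)) ⟨
  1 * g 0 + sumRange (λ j → (n C j) * g (suc j) + (n C suc j) * g (suc j)) 0 (suc n)
    ≡⟨ cong (1 * g 0 +_) (sumRange-cong 0 (suc n) λ j _ _ → pascal j) ⟩
  1 * g 0 + sumRange (λ j → (suc n C suc j) * g (suc j)) 0 (suc n)
    ≡⟨ cong (1 * g 0 +_) (sumRange-shift (λ j → (suc n C j) * g j) 0 (suc n)) ⟨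
  1 * g 0 + sumRange (λ j → (suc n C j) * g j) 1 (suc n)
    ∎
  where
  open ≡-Reasoning
  a+b+c≡a+[c+b] : ∀ a b c → a + b + c ≡ a + (c + b)
  a+b+c≡a+[c+b] = solve-∀
  pascal : ∀ j → (n C j) * g (suc j) + (n C suc j) * g (suc j) ≡ (suc n C suc j) * g (suc j)
  pascal j = trans (sym (*-distribʳ-+ (g (suc j)) (n C j) _)) (cong (_* g (suc j)) (nCk+nC[k+1]≡[n+1]C[k+1] n j))
  upper : sumRange (λ j → (n C j) * g j) 1 n ≡ sumRange (λ j → (n C suc j) * g (suc j)) 0 (suc n)
  upper = begin
    sumRange (λ j → (n C j) * g j) 1 n                          ≡⟨ +-identityʳ _ ⟨
    sumRange (λ j → (n C j) * g j) 1 n + 0                      ≡⟨ cong (λ c → sumRange (λ j → (n C j) * g j) 1 n + c * g (suc n)) (k>n⇒nCk≡0 (n<1+n n)) ⟨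
    sumRange (λ j → (n C j) * g j) 1 n + (n C suc n) * g (suc n)  ≡⟨ sumRange-snoc (λ j → (n C j) * g j) 1 n ⟨
    sumRange (λ j → (n C j) * g j) 1 (suc n)                    ≡⟨ sumRange-shift (λ j → (n C j) * g j) 0 (suc n) ⟩
    sumRange (λ j → (n C suc j) * g (suc j)) 0 (suc n)          ∎

binomialSum[p]≡g0+gp : ∀ {p} .{{_ : NonZero p}} g → Prime p → binomialSum p g % p ≡ (g 0 + g p) % p
binomialSum[p]≡g0+gp {p@(suc q)} g p-prime =
  trans (cong (_% p) expansion) (%-remove-+ʳ (g 0 + g p) (sumRange-∣ _ 1 q p∣terms))
  where
  inner : ℕ
  inner = sumRange (λ j → (p C j) * g j) 1 q
  p∣terms : ∀ j → 1 ≤ j → j < 1 + q → p ∣ (p C j) * g j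
  p∣terms j 0<j j<p = ∣-trans (prime∣pCk p-prime 0<j j<p) (m∣m*n (g j))
  expansion : binomialSum p g ≡ g 0 + g p + inner
  expansion = begin
    binomialSum p g                                ≡⟨ binomialSum≡Σ p g ⟩
    1 * g 0 + sumRange (λ j → (p C j) * g j) 1 p   ≡⟨ cong (1 * g 0 +_) (sumRange-snoc (λ j → (p C j) * g j) 1 q) ⟩
    1 * g 0 + (inner + (p C p) * g p)               ≡⟨ cong (λ c → 1 * g 0 + (inner + c * g p)) (nCn≡1 p) ⟩
    1 * g 0 + (inner + 1 * g p)                     ≡⟨ 1*a+[x+1*b]≡a+b+x (g 0) inner (g p) ⟩
    g 0 + g p + inner                               ∎
    where
    open ≡-Reasoning
    1*a+[x+1*b]≡a+b+x : ∀ a x b → 1 * a + (x + 1 * b) ≡ a + b + x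
    1*a+[x+1*b]≡a+b+x = solve-∀

-- cyc c₀ c₁ c₂ c₃ c₄ stands for c₀ + c₁x + c₂x² + c₃x³ + c₄x⁴ in ℕ[x]/(x⁵ − 1), and mul-y multiplies
-- by y = x² + x³.
data Cyclic₅ : Set where
  cyc : (c₀ c₁ c₂ c₃ c₄ : ℕ) → Cyclic₅

mul-y : Cyclic₅ → Cyclic₅
mul-y (cyc c₀ c₁ c₂ c₃ c₄) = cyc (c₃ + c₂) (c₄ + c₃) (c₀ + c₄) (c₁ + c₀) (c₂ + c₁)

y^ : ℕ → Cyclic₅
y^ zero    = cyc 1 0 0 0 0
y^ (suc n) = mul-y (y^ n)

⟪_,_⟫ : Cyclic₅ → (ℕ → ℕ) → ℕ
⟪ cyc c₀ c₁ c₂ c₃ c₄ , G ⟫ = c₀ * G 0 + c₁ * G 1 + c₂ * G 2 + c₃ * G 3 + c₄ * G 4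

⟪mul-y⟫ : ∀ v G → ⟪ mul-y v , G ⟫ ≡ ⟪ v , (λ s → G ((s + 2) % 5)) ⟫ + ⟪ v , (λ s → G ((s + 3) % 5)) ⟫
⟪mul-y⟫ (cyc c₀ c₁ c₂ c₃ c₄) G = ⟪mul-y⟫-components c₀ c₁ c₂ c₃ c₄ (G 0) (G 1) (G 2) (G 3) (G 4)
  where
  ⟪mul-y⟫-components : ∀ c₀ c₁ c₂ c₃ c₄ g₀ g₁ g₂ g₃ g₄ →
    (c₃ + c₂) * g₀ + (c₄ + c₃) * g₁ + (c₀ + c₄) * g₂ + (c₁ + c₀) * g₃ + (c₂ + c₁) * g₄
    ≡ (c₀ * g₂ + c₁ * g₃ + c₂ * g₄ + c₃ * g₀ + c₄ * g₁) + (c₀ * g₃ + c₁ * g₄ + c₂ * g₀ + c₃ * g₁ + c₄ * g₂)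
  ⟪mul-y⟫-components = solve-∀

[m%n+k]%n≡[m+k]%n : ∀ m k n .{{_ : NonZero n}} → (m % n + k) % n ≡ (m + k) % n
[m%n+k]%n≡[m+k]%n m k n = begin
  (m % n + k) % n            ≡⟨ %-distribˡ-+ (m % n) k n ⟩
  (m % n % n + k % n) % n    ≡⟨ cong (λ r → (r + k % n) % n) (m%n%n≡m%n m n) ⟩
  (m % n + k % n) % n        ≡⟨ %-distribˡ-+ m k n ⟨
  (m + k) % n                ∎
  where open ≡-Reasoning

⟪y^⟫≡binomialSum : ∀ n G → ⟪ y^ n , G ⟫ ≡ binomialSum n (λ j → G ((2 * n + j) % 5))
⟪y^⟫≡binomialSum zero    G = ⟪1⟫≡g₀ (G 0) (G 1) (G 2) (G 3) (G 4)
  where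
  ⟪1⟫≡g₀ : ∀ g₀ g₁ g₂ g₃ g₄ → 1 * g₀ + 0 * g₁ + 0 * g₂ + 0 * g₃ + 0 * g₄ ≡ g₀
  ⟪1⟫≡g₀ = solve-∀
⟪y^⟫≡binomialSum (suc n) G = begin
  ⟪ mul-y (y^ n) , G ⟫
    ≡⟨ ⟪mul-y⟫ (y^ n) G ⟩
  ⟪ y^ n , (λ s → G ((s + 2) % 5)) ⟫ + ⟪ y^ n , (λ s → G ((s + 3) % 5)) ⟫
    ≡⟨ cong₂ _+_ (⟪y^⟫≡binomialSum n _) (⟪y^⟫≡binomialSum n _) ⟩
  binomialSum n (λ j → G (((2 * n + j) % 5 + 2) % 5)) + binomialSum n (λ j → G (((2 * n + j) % 5 + 3) % 5))
    ≡⟨ cong₂ _+_ (binomialSum-cong n λ j → cong G (trans ([m%n+k]%n≡[m+k]%n (2 * n + j) 2 5) (cong (_% 5) (index₁ n j))))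
                 (binomialSum-cong n λ j → cong G (trans ([m%n+k]%n≡[m+k]%n (2 * n + j) 3 5) (cong (_% 5) (index₂ n j)))) ⟩
  binomialSum n (λ j → G ((2 * suc n + j) % 5)) + binomialSum n (λ j → G ((2 * suc n + suc j) % 5))
    ∎
  where
  open ≡-Reasoning
  index₁ : ∀ n j → 2 * n + j + 2 ≡ 2 * suc n + j
  index₁ = solve-∀
  index₂ : ∀ n j → 2 * n + j + 3 ≡ 2 * suc n + suc j
  index₂ = solve-∀

-- a(1 + x + x² + x³ + x⁴) + u(x + x⁴) + w(x² + x³)
oddShape : ℕ → ℕ → ℕ → Cyclic₅
oddShape a u w = cyc a (a + u) (a + w) (a + w) (a + u)

cyc-cong : ∀ {a₀ a₁ a₂ a₃ a₄ b₀ b₁ b₂ b₃ b₄} → a₀ ≡ b₀ → a₁ ≡ b₁ → a₂ ≡ b₂ → a₃ ≡ b₃ → a₄ ≡ b₄ →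
  cyc a₀ a₁ a₂ a₃ a₄ ≡ cyc b₀ b₁ b₂ b₃ b₄
cyc-cong refl refl refl refl refl = refl

mul-y²-oddShape : ∀ a u v → mul-y (mul-y (oddShape a u (v + u))) ≡ oddShape (2 * (2 * a + u)) (v + u) (v + u + v + (v + u))
mul-y²-oddShape a u v = cyc-cong (solve (a ∷ u ∷ v ∷ [])) (solve (a ∷ u ∷ v ∷ [])) (solve (a ∷ u ∷ v ∷ [])) (solve (a ∷ u ∷ v ∷ [])) (solve (a ∷ u ∷ v ∷ []))

y^[1+2t]≡oddShape : ∀ t → ∃ λ a → y^ (suc (2 * t)) ≡ oddShape a (F (2 * t)) (F (2 + 2 * t))
y^[1+2t]≡oddShape zero = 0 , refl
y^[1+2t]≡oddShape (suc t) with y^[1+2t]≡oddShape t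
... | a , y^[1+2t]≡shape = 2 * (2 * a + F (2 * t)) , (begin
  y^ (suc (2 * suc t))                                          ≡⟨ cong (y^ ∘ suc) (*-suc 2 t) ⟩
  mul-y (mul-y (y^ (suc (2 * t))))                              ≡⟨ cong (mul-y ∘ mul-y) y^[1+2t]≡shape ⟩
  mul-y (mul-y (oddShape a (F (2 * t)) (F (2 + 2 * t))))        ≡⟨ mul-y²-oddShape a (F (2 * t)) (F (1 + 2 * t)) ⟩
  oddShape (2 * (2 * a + F (2 * t))) (F (2 + 2 * t)) (F (4 + 2 * t))
    ≡⟨ cong (λ i → oddShape (2 * (2 * a + F (2 * t))) (F i) (F (2 + i))) (*-suc 2 t) ⟨
  oddShape (2 * (2 * a + F (2 * t))) (F (2 * suc t)) (F (2 + 2 * suc t)) ∎)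
  where open ≡-Reasoning

⟪y^p⟫≡G[2p]+G[3p] : ∀ {p} .{{_ : NonZero p}} G → Prime p → ⟪ y^ p , G ⟫ % p ≡ (G ((2 * p) % 5) + G ((3 * p) % 5)) % p
⟪y^p⟫≡G[2p]+G[3p] {p} G p-prime = begin
  ⟪ y^ p , G ⟫ % p                                   ≡⟨ cong (_% p) (⟪y^⟫≡binomialSum p G) ⟩
  binomialSum p (λ j → G ((2 * p + j) % 5)) % p      ≡⟨ binomialSum[p]≡g0+gp _ p-prime ⟩
  (G ((2 * p + 0) % 5) + G ((2 * p + p) % 5)) % p    ≡⟨ cong₂ (λ i j → (G (i % 5) + G (j % 5)) % p) (+-identityʳ (2 * p)) (2p+p≡3p p) ⟩
  (G ((2 * p) % 5) + G ((3 * p) % 5)) % p            ∎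
  where
  open ≡-Reasoning
  2p+p≡3p : ∀ p → 2 * p + p ≡ 3 * p
  2p+p≡3p = solve-∀

δ : ℕ → ℕ → ℕ
δ r s = if s ≡ᵇ r then 1 else 0

⟪y^p⟫≡G4+G1 : ∀ {p} .{{_ : NonZero p}} G → Prime p → p % 5 ≡ 2 → ⟪ y^ p , G ⟫ % p ≡ (G 4 + G 1) % p
⟪y^p⟫≡G4+G1 {p} G p-prime p%5≡2 =
  trans (⟪y^p⟫≡G[2p]+G[3p] G p-prime) (cong₂ (λ i j → (G i + G j) % p) [2p]%5≡4 [3p]%5≡1)
  where
  [2p]%5≡4 : (2 * p) % 5 ≡ 4
  [2p]%5≡4 = trans (%-distribˡ-* 2 p 5) (cong (λ r → (2 * r) % 5) p%5≡2)
  [3p]%5≡1 : (3 * p) % 5 ≡ 1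
  [3p]%5≡1 = trans (%-distribˡ-* 3 p 5) (cong (λ r → (3 * r) % 5) p%5≡2)

oddShape-coefficients : ∀ a u w → ⟪ oddShape a u w , δ 0 ⟫ ≡ a
  × ⟪ oddShape a u w , δ 1 ⟫ ≡ a + u × ⟪ oddShape a u w , δ 2 ⟫ ≡ a + w
oddShape-coefficients a u w = ⟪oddShape,δ0⟫ a u w , ⟪oddShape,δ1⟫ a u w , ⟪oddShape,δ2⟫ a u w
  where
  ⟪oddShape,δ0⟫ : ∀ a u w → a * 1 + (a + u) * 0 + (a + w) * 0 + (a + w) * 0 + (a + u) * 0 ≡ a
  ⟪oddShape,δ0⟫ = solve-∀
  ⟪oddShape,δ1⟫ : ∀ a u w → a * 0 + (a + u) * 1 + (a + w) * 0 + (a + w) * 0 + (a + u) * 0 ≡ a + u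
  ⟪oddShape,δ1⟫ = solve-∀
  ⟪oddShape,δ2⟫ : ∀ a u w → a * 0 + (a + u) * 0 + (a + w) * 1 + (a + w) * 0 + (a + u) * 0 ≡ a + w
  ⟪oddShape,δ2⟫ = solve-∀

F[p-1]≡1×F[p+1]≡0 : ∀ t → Prime (suc (2 * t)) → suc (2 * t) % 5 ≡ 2 →
  F (2 * t) % suc (2 * t) ≡ 1 % suc (2 * t) × F (2 + 2 * t) % suc (2 * t) ≡ 0
F[p-1]≡1×F[p+1]≡0 t p-prime p%5≡2 with y^[1+2t]≡oddShape t
... | a , y^p≡shape with oddShape-coefficients a (F (2 * t)) (F (2 + 2 * t))
...   | c₀ , c₁ , c₂ = F[p-1]≡1 , F[p+1]≡0
  where
  p : ℕ
  p = suc (2 * t)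
  coefficient : ∀ r → ⟪ oddShape a (F (2 * t)) (F (2 + 2 * t)) , δ r ⟫ % p ≡ (δ r 4 + δ r 1) % p
  coefficient r = trans (cong (λ v → ⟪ v , δ r ⟫ % p) (sym y^p≡shape)) (⟪y^p⟫≡G4+G1 (δ r) p-prime p%5≡2)
  p∣a : p ∣ a
  p∣a = m%n≡0⇒n∣m a p (trans (cong (_% p) (sym c₀)) (coefficient 0))
  F[p-1]≡1 : F (2 * t) % p ≡ 1 % p
  F[p-1]≡1 = trans (sym (%-remove-+ˡ (F (2 * t)) p∣a)) (trans (cong (_% p) (sym c₁)) (coefficient 1))
  F[p+1]≡0 : F (2 + 2 * t) % p ≡ 0
  F[p+1]≡0 = trans (sym (%-remove-+ˡ (F (2 + 2 * t)) p∣a)) (trans (cong (_% p) (sym c₂)) (coefficient 2))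

weightedSum : ℕ → ℕ
weightedSum n = 3 ^ n + sumRange (λ i → 3 ^ (n ∸ i) * F (3 * i ∸ 1)) 1 n

weightedSum-suc : ∀ n → weightedSum (suc n) ≡ 3 * weightedSum n + F (2 + 3 * n)
weightedSum-suc n = begin
  3 * 3 ^ n + sumRange (term (suc n)) 1 (suc n)                ≡⟨ cong (3 * 3 ^ n +_) (sumRange-snoc (term (suc n)) 1 n) ⟩
  3 * 3 ^ n + (sumRange (term (suc n)) 1 n + term (suc n) (suc n))
    ≡⟨ cong₂ (λ s t → 3 * 3 ^ n + (s + t)) (sumRange-cong 1 n term[1+n]≡3*term[n]) last-term ⟩
  3 * 3 ^ n + (sumRange (λ i → 3 * term n i) 1 n + F (2 + 3 * n))  ≡⟨ cong (λ s → 3 * 3 ^ n + (s + F (2 + 3 * n))) (sumRange-*ˡ (term n) 3 1 n) ⟩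
  3 * 3 ^ n + (3 * sumRange (term n) 1 n + F (2 + 3 * n))       ≡⟨ 3a+[3s+f]≡3[a+s]+f (3 ^ n) _ _ ⟩
  3 * weightedSum n + F (2 + 3 * n)                              ∎
  where
  open ≡-Reasoning
  term : ℕ → ℕ → ℕ
  term n i = 3 ^ (n ∸ i) * F (3 * i ∸ 1)
  term[1+n]≡3*term[n] : ∀ i → 1 ≤ i → i < 1 + n → term (suc n) i ≡ 3 * term n i
  term[1+n]≡3*term[n] i _ (s≤s i≤n) = trans (cong (λ e → 3 ^ e * F (3 * i ∸ 1)) (+-∸-assoc 1 i≤n)) (*-assoc 3 (3 ^ (n ∸ i)) (F (3 * i ∸ 1)))
  last-term : term (suc n) (suc n) ≡ F (2 + 3 * n)
  last-term = trans (cong₂ (λ e i → 3 ^ e * F (i ∸ 1)) (n∸n≡0 n) (*-suc 3 n)) (*-identityˡ _)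
  3a+[3s+f]≡3[a+s]+f : ∀ a s f → 3 * a + (3 * s + f) ≡ 3 * (a + s) + f
  3a+[3s+f]≡3[a+s]+f = solve-∀

2*weightedSum≡F[3[1+n]] : ∀ n → 2 * weightedSum n ≡ F (3 * suc n)
2*weightedSum≡F[3[1+n]] zero    = refl
2*weightedSum≡F[3[1+n]] (suc n) = begin
  2 * weightedSum (suc n)                              ≡⟨ cong (2 *_) (weightedSum-suc n) ⟩
  2 * (3 * weightedSum n + F (2 + 3 * n))              ≡⟨ 2[3w+f]≡3[2w]+2f (weightedSum n) (F (2 + 3 * n)) ⟩
  3 * (2 * weightedSum n) + 2 * F (2 + 3 * n)          ≡⟨ cong (λ s → 3 * s + 2 * F (2 + 3 * n)) (2*weightedSum≡F[3[1+n]] n) ⟩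
  3 * F (3 * suc n) + 2 * F (2 + 3 * n)                ≡⟨ cong (λ i → 3 * F i + 2 * F (2 + 3 * n)) (*-suc 3 n) ⟩
  3 * F (3 + 3 * n) + 2 * F (2 + 3 * n)                ≡⟨ F[6+x]≡3F[3+x]+2F[2+x] (F (1 + 3 * n)) (F (3 * n)) ⟨
  F (6 + 3 * n)                                        ≡⟨ cong F (3[2+n]≡6+3n n) ⟨
  F (3 * suc (suc n))                                  ∎
  where
  open ≡-Reasoning
  2[3w+f]≡3[2w]+2f : ∀ w f → 2 * (3 * w + f) ≡ 3 * (2 * w) + 2 * f
  2[3w+f]≡3[2w]+2f = solve-∀
  F[6+x]≡3F[3+x]+2F[2+x] : ∀ u v → ((u + v) + u + (u + v) + ((u + v) + u)) + ((u + v) + u + (u + v))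
                                      ≡ 3 * ((u + v) + u) + 2 * (u + v)
  F[6+x]≡3F[3+x]+2F[2+x] = solve-∀
  3[2+n]≡6+3n : ∀ n → 3 * suc (suc n) ≡ 6 + 3 * n
  3[2+n]≡6+3n = solve-∀

F[5k+1]≡1×F[5k+3]≡0 : ∀ j → Prime (2 + 5 * (2 * j + 1)) →
  F (1 + 5 * (2 * j + 1)) % (2 + 5 * (2 * j + 1)) ≡ 1 % (2 + 5 * (2 * j + 1))
  × F (3 + 5 * (2 * j + 1)) % (2 + 5 * (2 * j + 1)) ≡ 0
F[5k+1]≡1×F[5k+3]≡0 j p-prime =
  subst (λ x → F x % suc x ≡ 1 % suc x × F (2 + x) % suc x ≡ 0) 2t≡1+K
    (F[p-1]≡1×F[p+1]≡0 t (subst (Prime ∘ suc) (sym 2t≡1+K) p-prime) p%5≡2)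
  where
  t : ℕ
  t = 5 * j + 3
  2t≡1+K : 2 * t ≡ 1 + 5 * (2 * j + 1)
  2t≡1+K = 2[5j+3]≡1+5[2j+1] j
    where
    2[5j+3]≡1+5[2j+1] : ∀ j → 2 * (5 * j + 3) ≡ 1 + 5 * (2 * j + 1)
    2[5j+3]≡1+5[2j+1] = solve-∀
  p%5≡2 : suc (2 * t) % 5 ≡ 2
  p%5≡2 = trans (cong (_% 5) (1+2[5j+3]≡2+[2j+1]*5 j)) ([m+kn]%n≡m%n 2 (2 * j + 1) 5)
    where
    1+2[5j+3]≡2+[2j+1]*5 : ∀ j → suc (2 * (5 * j + 3)) ≡ 2 + (2 * j + 1) * 5
    1+2[5j+3]≡2+[2j+1]*5 = solve-∀

theorem3p5 : (k m : ℕ) → (∃ λ j → k ≡ 2 * j + 1) → Prime (2 + 5 * k) → m > 2 →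
    ((F (5 * m * k) % (2 + 5 * k) ≡ (5 * k * (3 ^ (m ∸ 1) + sumRange (λ i → 3 ^ (m ∸ 1 ∸ i) * F (3 * i ∸ 1)) 1 (m ∸ 1))) % (2 + 5 * k))
    × (F (5 * m * k + 1) % (2 + 5 * k) ≡ F (3 * m ∸ 1) % (2 + 5 * k)))
theorem3p5 k zero _ _ ()
theorem3p5 k (suc n) (j , refl) p-prime _ =
  subst (λ N → F N % P ≡ (K * weightedSum n) % P × F (N + 1) % P ≡ F (3 * suc n ∸ 1) % P)
    (sym (5*m*k≡m*[5*k] (suc n) (2 * j + 1)))
    (F[mK]≡K*S×F[mK+1]≡F[3m-1] K F[1+K]≡1 F[3+K]≡0 n (weightedSum n) (2*weightedSum≡F[3[1+n]] n))
  where
  K P : ℕ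
  K = 5 * (2 * j + 1)
  P = 2 + K
  F[1+K]≡1 : F (1 + K) % P ≡ 1 % P
  F[1+K]≡1 = proj₁ (F[5k+1]≡1×F[5k+3]≡0 j p-prime)
  F[3+K]≡0 : F (3 + K) % P ≡ 0
  F[3+K]≡0 = proj₂ (F[5k+1]≡1×F[5k+3]≡0 j p-prime)
  5*m*k≡m*[5*k] : ∀ m k → 5 * m * k ≡ m * (5 * k)
  5*m*k≡m*[5*k] = solve-∀
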